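{- Let $G$ be a core graph on at most $n\ge3$ vertices, and let $\delta>0$ be the minimal degree of a vertex of $G$. Let $m:=\lfloor\frac{n-1}{\delta}\rfloor+1$. Then $\mathrm{Pol}(G)$ contains no semiprojection of arity $\ge m+1$.
   Context: Graphs are finite, simple, undirected, loopless. $G$ is a core if every homomorphism $G\to G$ is bijective. $\mathrm{Pol}(G)$ is the set of maps $f:V_G^M\to V_G$ ($M\ge1$) such that whenever $(a_j,b_j)\in E_G$ for all $j$, $(f(a_1,\dots,a_M),f(b_1,\dots,b_M))\in E_G$. A semiprojection is a function $f$ of arity $M\ge2$ that is not a projection and for which there is $i\in[M]$ such that $f(x_1,\dots,x_M)=x_i$ whenever $|\{x_1,\dots,x_M\}|<M$. -}

module Defs where

open import Data.Nat using (ℕ; suc; _+_; _∸_; _≤_; _<_; NonZero)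
open import Data.Nat.DivMod using (_/_)
open import Data.Fin using (Fin)
open import Data.Bool using (Bool; true; false; T)
open import Data.List using (length; filterᵇ; allFin)
open import Data.Product using (Σ; ∃; ∃₂; _×_)
open import Relation.Nullary using (¬_)
open import Relation.Binary.PropositionalEquality using (_≡_; _≢_)
open import Function.Definitions using (Bijective)

record Graph (k : ℕ) : Set where
  field
    adj       : Fin k → Fin k → Bool
    symmetric : ∀ u v → adj u v ≡ adj v u
    loopless  : ∀ u → adj u u ≡ false

open Graph public

E : ∀ {k} → Graph k → Fin k → Fin k → Set
E G u v = T (adj G u v)

degree : ∀ {k} → Graph k → Fin k → ℕ
degree {k} G u = length (filterᵇ (adj G u) (allFin k))

IsMinDegree : ∀ {k} → Graph k → ℕ → Set
IsMinDegree G δ = (∀ v → δ ≤ degree G v) × (∃ λ v → degree G v ≡ δ)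

IsEndo : ∀ {k} → Graph k → (Fin k → Fin k) → Set
IsEndo G h = ∀ u v → E G u v → E G (h u) (h v)

IsCore : ∀ {k} → Graph k → Set
IsCore G = ∀ h → IsEndo G h → Bijective _≡_ _≡_ h

Op : ℕ → ℕ → Set
Op k M = (Fin M → Fin k) → Fin k

IsPol : ∀ {k M} → Graph k → Op k M → Set
IsPol {M = M} G f =
  ∀ (a b : Fin M → Fin _) → (∀ j → E G (a j) (b j)) → E G (f a) (f b)

IsProjection : ∀ {k M} → Op k M → Set
IsProjection {M = M} f = ∃ λ (i : Fin M) → ∀ x → f x ≡ x i

-- |{x_1,…,x_M}| < M, i.e. some two coordinates coincide
HasRepeat : ∀ {k M} → (Fin M → Fin k) → Set
HasRepeat {M = M} x = ∃₂ λ (j l : Fin M) → j ≢ l × x j ≡ x l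

IsSemiprojection : ∀ {k M} → Op k M → Set
IsSemiprojection {M = M} f =
  2 ≤ M × ¬ IsProjection f ×
  (∃ λ (i : Fin M) → ∀ x → HasRepeat x → f x ≡ x i)

mBound : (n δ : ℕ) → .{{NonZero δ}} → ℕ
mBound n δ = (n ∸ 1) / δ + 1

{-# OPTIONS --safe #-}
-- If f is a semiprojection onto coordinate i, then for every tuple a every neighbour c of
-- a i is a neighbour of f a: the neighbourhoods of the coordinates other than i, together
-- with {c}, have total size at least 1 + (M - 1) δ > n, so two of them meet, and a
-- transversal b through the common vertex has a repeat, whence f a ~ f b = b i = c.
-- In a core no vertex has its neighbourhood inside that of another vertex (folding it
-- onto the other would be a non-injective endomorphism), so f a = a i.
module Submission where

open import Defs
open import Data.Nat using (ℕ; _≤_; _<_; suc; NonZero; >-nonZero)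
open import Relation.Nullary using (¬_)

open import Data.Bool using (Bool; true; false; T; T?; _∨_)
open import Data.Bool.Properties using (T-∨)
open import Data.Fin as Fin using (Fin; _≟_; punchIn)
open import Data.Fin.Properties using (any?; suc-injective; punchInᵢ≢i)
open import Data.List using ([]; _∷_; length; filterᵇ; allFin)
open import Data.List.Membership.Propositional.Properties using (∈-allFin)
open import Data.List.Properties using (length-filter; length-tabulate; filter-some; filter-none)
import Data.List.Relation.Unary.All as All
import Data.List.Relation.Unary.Any as Any
open import Data.Nat using (zero; _+_; _*_; _/_; _%_; z≤n; s≤s⁻¹)
open import Data.Nat.DivMod using (m≡m%n+[m/n]*n; m%n<n)
open import Data.Nat.Properties
  using (≤-trans; ≤-reflexive; <⇒≱; +-suc; +-comm; *-identityˡ; *-distribʳ-+; +-mono-≤; +-monoʳ-≤;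
         +-monoˡ-<; *-monoˡ-≤; module ≤-Reasoning; +-0-commutativeMonoid)
open import Data.Product using (∃; ∃₂; _×_; _,_; proj₁; proj₂)
open import Data.Sum using (_⊎_; inj₁; inj₂)
open import Data.Vec.Functional using (Vector; head; tail; updateAt; removeAt)
open import Data.Vec.Functional.Properties using (updateAt-updates; updateAt-minimal)
open import Function using (_∘_; id; const; Equivalence)
open import Relation.Binary.PropositionalEquality using (_≡_; _≢_; refl; sym; trans; cong; subst)
open import Relation.Nullary using (yes; no; contradiction)
open import Relation.Nullary.Decidable using (⌊_⌋; toWitness; fromWitness; _×-dec_)
open import Algebra.Properties.CommutativeMonoid.Sum +-0-commutativeMonoid using (sum; sum-remove)

lowerBound⇒*≤sum : ∀ {r} d (t : Vector ℕ r) → (∀ j → d ≤ t j) → r * d ≤ sum t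
lowerBound⇒*≤sum {zero}  d t d≤t = z≤n
lowerBound⇒*≤sum {suc r} d t d≤t = +-mono-≤ (d≤t Fin.zero) (lowerBound⇒*≤sum d (tail t) (d≤t ∘ Fin.suc))

lowerBoundExcept⇒≤sum : ∀ {r} d (t : Vector ℕ (suc r)) i → (∀ j → j ≢ i → d ≤ t j) →
  t i + r * d ≤ sum t
lowerBoundExcept⇒≤sum {r} d t i d≤t = begin
  t i + r * d                ≤⟨ +-monoʳ-≤ (t i) (lowerBound⇒*≤sum d (removeAt t i) d≤t∘punchIn) ⟩
  t i + sum (removeAt t i)   ≡⟨ sum-remove t ⟨
  sum t                      ∎
  where
  open ≤-Reasoning
  d≤t∘punchIn : ∀ j → d ≤ t (punchIn i j)
  d≤t∘punchIn j = d≤t (punchIn i j) (punchInᵢ≢i i j)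

m<[m/n+1]*n : ∀ m n .{{_ : NonZero n}} → m < (m / n + 1) * n
m<[m/n+1]*n m n = begin-strict
  m                  ≡⟨ m≡m%n+[m/n]*n m n ⟩
  m % n + m / n * n  <⟨ +-monoˡ-< (m / n * n) (m%n<n m n) ⟩
  n + m / n * n      ≡⟨ +-comm n (m / n * n) ⟩
  m / n * n + n      ≡⟨ cong (m / n * n +_) (*-identityˡ n) ⟨
  m / n * n + 1 * n  ≡⟨ *-distribʳ-+ n (m / n) 1 ⟨
  (m / n + 1) * n    ∎
  where open ≤-Reasoning

length-filterᵇ-∨ : ∀ {A : Set} (p q : A → Bool) xs → (∀ w → T (p w) → ¬ T (q w)) →
  length (filterᵇ (λ w → p w ∨ q w) xs) ≡ length (filterᵇ p xs) + length (filterᵇ q xs)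
length-filterᵇ-∨ p q [] disjoint = refl
length-filterᵇ-∨ p q (x ∷ xs) disjoint with p x in px | q x in qx
... | true  | true  = contradiction (subst T (sym qx) _) (disjoint x (subst T (sym px) _))
... | true  | false = cong suc (length-filterᵇ-∨ p q xs disjoint)
... | false | true  = trans (cong suc (length-filterᵇ-∨ p q xs disjoint))
                           (sym (+-suc (length (filterᵇ p xs)) (length (filterᵇ q xs))))
... | false | false = length-filterᵇ-∨ p q xs disjoint

Overlap : ∀ {A : Set} {r} → (Fin r → A → Set) → Set
Overlap {r = r} P = ∃₂ λ (j l : Fin r) → j ≢ l × ∃ λ w → P j w × P l w

module _ {k : ℕ} where

  count : (Fin k → Bool) → ℕ
  count p = length (filterᵇ p (allFin k))

  count≤ : ∀ p → count p ≤ k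
  count≤ p = ≤-trans (length-filter (T? ∘ p) (allFin k)) (≤-reflexive (length-tabulate id))

  T⇒count>0 : ∀ p {w} → T (p w) → 0 < count p
  T⇒count>0 p {w} pw = filter-some (T? ∘ p) (Any.map (λ { refl → pw }) (∈-allFin w))

  count>0⇒∃T : ∀ p → 0 < count p → ∃ (T ∘ p)
  count>0⇒∃T p count>0 with any? (T? ∘ p)
  ... | yes ∃pw = ∃pw
  ... | no  ∄pw = contradiction (subst (λ ws → 0 < length ws) empty count>0) λ ()
    where
    empty : filterᵇ p (allFin k) ≡ []
    empty = filter-none (T? ∘ p) {allFin k} (All.tabulate λ {w} _ pw → ∄pw (w , pw))

  ⋃ : ∀ {r} → Vector (Fin k → Bool) r → Fin k → Bool
  ⋃ {zero}  P w = false
  ⋃ {suc r} P w = head P w ∨ ⋃ (tail P) w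

  T-⋃⇒∃ : ∀ {r} (P : Vector (Fin k → Bool) r) w → T (⋃ P w) → ∃ λ l → T (P l w)
  T-⋃⇒∃ {suc r} P w p with Equivalence.to (T-∨ {head P w} {⋃ (tail P) w}) p
  ... | inj₁ p₀ = Fin.zero , p₀
  ... | inj₂ p⋃ = let l , pl = T-⋃⇒∃ (tail P) w p⋃ in Fin.suc l , pl

  overlap⊎sum≤count⋃ : ∀ {r} (P : Vector (Fin k → Bool) r) →
    Overlap (λ j w → T (P j w)) ⊎ sum (count ∘ P) ≤ count (⋃ P)
  overlap⊎sum≤count⋃ {zero}  P = inj₂ z≤n
  overlap⊎sum≤count⋃ {suc r} P with overlap⊎sum≤count⋃ (tail P)
  ... | inj₁ (j , l , j≢l , w , pj , pl) =
    inj₁ (Fin.suc j , Fin.suc l , j≢l ∘ suc-injective , w , pj , pl)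
  ... | inj₂ sum≤ with any? (λ w → T? (head P w) ×-dec T? (⋃ (tail P) w))
  ...   | yes (w , p₀ , p⋃) = let l , pl = T-⋃⇒∃ (tail P) w p⋃ in
    inj₁ (Fin.zero , Fin.suc l , (λ ()) , w , p₀ , pl)
  ...   | no disjoint = inj₂ (begin
    count (head P) + sum (count ∘ tail P)  ≤⟨ +-monoʳ-≤ (count (head P)) sum≤ ⟩
    count (head P) + count (⋃ (tail P))    ≡⟨ length-filterᵇ-∨ (head P) (⋃ (tail P)) (allFin k)
                                                (λ w p₀ p⋃ → disjoint (w , p₀ , p⋃)) ⟨
    count (⋃ P)                            ∎)
    where open ≤-Reasoning

  pigeonhole : ∀ {r} (P : Vector (Fin k → Bool) r) → k < sum (count ∘ P) →
    Overlap (λ j w → T (P j w))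
  pigeonhole P k<sum with overlap⊎sum≤count⋃ P
  ... | inj₁ meet = meet
  ... | inj₂ sum≤ = contradiction (≤-trans sum≤ (count≤ (⋃ P))) (<⇒≱ k<sum)

  updateAt-const-preserves : ∀ {r} {P : Fin r → Fin k → Set} {xs : Vector (Fin k) r} i {y} →
    (∀ x → P x (xs x)) → P i y → ∀ x → P x (updateAt xs i (const y) x)
  updateAt-const-preserves {P = P} {xs} i Pxs Piy x with x ≟ i
  ... | yes refl = subst (P i) (sym (updateAt-updates i xs)) Piy
  ... | no  x≢i  = subst (P x) (sym (updateAt-minimal x i xs x≢i)) (Pxs x)

  overlap⇒repeatingTransversal : ∀ {r} (P : Fin r → Fin k → Set) → (∀ x → ∃ (P x)) →
    Overlap P → ∃ λ b → (∀ x → P x (b x)) × HasRepeat b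
  overlap⇒repeatingTransversal P choice (j , l , j≢l , w , Pjw , Plw) =
    b , b∈P , j , l , j≢l , trans bj≡w (sym bl≡w)
    where
    b′ = updateAt (proj₁ ∘ choice) j (const w)
    b  = updateAt b′ l (const w)
    b∈P : ∀ x → P x (b x)
    b∈P = updateAt-const-preserves {P = P} l (updateAt-const-preserves {P = P} j (proj₂ ∘ choice) Pjw) Plw
    bj≡w : b j ≡ w
    bj≡w = trans (updateAt-minimal j l b′ j≢l) (updateAt-updates j (proj₁ ∘ choice))
    bl≡w : b l ≡ w
    bl≡w = updateAt-updates l b′

Nbhd⊆ : ∀ {k} → Graph k → Fin k → Fin k → Set
Nbhd⊆ G u v = ∀ w → E G u w → E G v w

module _ {k} (G : Graph k) where

  E-sym : ∀ {u v} → E G u v → E G v u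
  E-sym {u} {v} = subst T (symmetric G u v)

  fold : Fin k → Fin k → Fin k → Fin k
  fold u v w with w ≟ u
  ... | yes _ = v
  ... | no  _ = w

  fold-isEndo : ∀ {u v} → Nbhd⊆ G u v → IsEndo G (fold u v)
  fold-isEndo {u} {v} N⊆ x y x~y with x ≟ u | y ≟ u
  ... | yes refl | yes refl = contradiction (subst T (loopless G u) x~y) λ ()
  ... | yes refl | no  _    = N⊆ y x~y
  ... | no  _    | yes refl = E-sym (N⊆ x (E-sym x~y))
  ... | no  _    | no  _    = x~y

  fold-at : ∀ u v → fold u v u ≡ v
  fold-at u v with u ≟ u
  ... | yes _   = refl
  ... | no  u≢u = contradiction refl u≢u

  fold-fixes : ∀ {u v w} → w ≢ u → fold u v w ≡ w
  fold-fixes {u} {v} {w} w≢u with w ≟ u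
  ... | yes w≡u = contradiction w≡u w≢u
  ... | no  _   = refl

  core⇒Nbhd⊆⇒≡ : IsCore G → ∀ {u v} → Nbhd⊆ G u v → u ≡ v
  core⇒Nbhd⊆⇒≡ core {u} {v} N⊆ with u ≟ v
  ... | yes u≡v = u≡v
  ... | no  u≢v = proj₁ (core (fold u v) (fold-isEndo N⊆))
                        (trans (fold-at u v) (sym (fold-fixes (u≢v ∘ sym))))

module _ {k r} (G : Graph k) {f : Op k (suc r)} (f∈Pol : IsPol G f) (i : Fin (suc r))
         (f-on-repeats : ∀ x → HasRepeat x → f x ≡ x i)
         {δ} (δ>0 : 0 < δ) (δ≤deg : ∀ v → δ ≤ degree G v) (k≤rδ : k ≤ r * δ) where

  semiprojection-Nbhd⊆ : ∀ a → Nbhd⊆ G (a i) (f a)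
  semiprojection-Nbhd⊆ a c aᵢ~c =
    let b , b∈P , b-repeats = overlap⇒repeatingTransversal (λ x w → T (P x w)) P-nonempty
                                (pigeonhole P k<sum)
    in subst (E G (f a)) (trans (f-on-repeats b b-repeats) (Pᵢ⇒≡c (b∈P i)))
             (f∈Pol a b λ x → P⇒E x (b∈P x))
    where
    P : Vector (Fin k → Bool) (suc r)
    P = updateAt (adj G ∘ a) i (const λ w → ⌊ w ≟ c ⌋)

    Pᵢ≡singleton : P i ≡ λ w → ⌊ w ≟ c ⌋
    Pᵢ≡singleton = updateAt-updates i (adj G ∘ a)

    P≡adj : ∀ {x} → x ≢ i → P x ≡ adj G (a x)
    P≡adj {x} x≢i = updateAt-minimal x i (adj G ∘ a) x≢i

    Pᵢ⇒≡c : ∀ {w} → T (P i w) → w ≡ c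
    Pᵢ⇒≡c {w} p = toWitness (subst (λ q → T (q w)) Pᵢ≡singleton p)

    Pᵢc : T (P i c)
    Pᵢc = subst (λ q → T (q c)) (sym Pᵢ≡singleton) (fromWitness refl)

    P⇒E : ∀ x {w} → T (P x w) → E G (a x) w
    P⇒E x {w} p with x ≟ i
    ... | yes refl = subst (E G (a i)) (sym (Pᵢ⇒≡c p)) aᵢ~c
    ... | no  x≢i  = subst (λ q → T (q w)) (P≡adj x≢i) p

    δ≤countP : ∀ x → x ≢ i → δ ≤ count (P x)
    δ≤countP x x≢i = subst (λ q → δ ≤ count q) (sym (P≡adj x≢i)) (δ≤deg (a x))

    P-nonempty : ∀ x → ∃ (T ∘ P x)
    P-nonempty x with x ≟ i
    ... | yes refl = c , Pᵢc
    ... | no  x≢i  = count>0⇒∃T (P x) (≤-trans δ>0 (δ≤countP x x≢i))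

    k<sum : k < sum (count ∘ P)
    k<sum = begin-strict
      k                    ≤⟨ k≤rδ ⟩
      r * δ                <⟨ +-monoˡ-< (r * δ) (T⇒count>0 (P i) Pᵢc) ⟩
      count (P i) + r * δ  ≤⟨ lowerBoundExcept⇒≤sum δ (count ∘ P) i δ≤countP ⟩
      sum (count ∘ P)      ∎
      where open ≤-Reasoning

lemma5p12 : (n : ℕ) → 3 ≤ n → (k : ℕ) → k ≤ n → (G : Graph k) → IsCore G →
    (δ : ℕ) → (δ>0 : 0 < δ) → IsMinDegree G δ →
    (M : ℕ) → suc (mBound n δ {{>-nonZero δ>0}}) ≤ M →
    (f : Op k M) → IsPol G f → ¬ IsSemiprojection f
lemma5p12 (suc n) _ k k≤n G core δ δ>0 (δ≤deg , _) (suc r) m<M f f∈Pol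
          (_ , ¬projection , i , f-on-repeats) =
  ¬projection (i , λ a → sym (core⇒Nbhd⊆⇒≡ G core
    (semiprojection-Nbhd⊆ G f∈Pol i f-on-repeats δ>0 δ≤deg k≤rδ a)))
  where
  instance
    δ≢0 : NonZero δ
    δ≢0 = >-nonZero δ>0
  k≤rδ : k ≤ r * δ
  k≤rδ = begin
    k                ≤⟨ k≤n ⟩
    suc n            ≤⟨ m<[m/n+1]*n n δ ⟩
    (n / δ + 1) * δ  ≤⟨ *-monoˡ-≤ δ (s≤s⁻¹ m<M) ⟩
    r * δ            ∎
    where open ≤-Reasoning
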